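{- Let $n\ge 2$ be an integer. For every integer $m\in\{n+1,\dots,2n-1\}$ there is a graph $G$ such that $\nu(H)=n$ and $\gamma(H)=m$ for every $H\in\Gamma_1(G)$.
   Context: A hypergraph $H$ has a finite non-empty vertex set and a collection of non-empty subsets (hyperedges); rank is the maximum hyperedge size. Two vertices are adjacent if some hyperedge contains both. $\nu(H)$ is the maximum number of pairwise disjoint hyperedges; $\gamma(H)$ is the minimum size of a set $D$ of vertices such that every vertex not in $D$ is adjacent to a vertex of $D$. Dilation of a simple graph $G$: for $k\ge 3$, assign to each vertex $v$ a positive integer $s_v$ with $s_u+s_v\le k$ for every edge $uv$; for each vertex $v$ let $\mathbf v$ be an $s_v$-set containing $v$, and for each edge $e=uv$ let $\mathbf e$ be a set of size at most $k-s_u-s_v$, all these sets pairwise disjoint. A dilation of $G$ is a hypergraph of rank $k$ with vertex set $\bigcup_v\mathbf v\cup\bigcup_e\mathbf e$ and hyperedges $\mathbf u\cup\mathbf v\cup\mathbf e$ for $e=uv\in E(G)$. $\Gamma_1(G)$ is the set of dilations of $G$ with $\mathbf e\neq\emptyset$ for every edge $e$. -}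

module Defs where

open import Level using (0ℓ)
open import Data.Nat using (ℕ; _+_; _≤_)
open import Data.Fin using (Fin)
import Data.Fin as Fin
open import Data.Bool using (Bool; T)
open import Data.Product using (Σ; ∃; _×_; _,_)
open import Data.Sum using (_⊎_; inj₁; inj₂)
open import Data.Empty using (⊥)
open import Relation.Nullary using (¬_)
open import Relation.Binary.PropositionalEquality using (_≡_)
open import Function.Definitions using (Injective)

record Hypergraph : Set₁ where
  field
    Vert  : Set
    HEdge : Set
    _∈ₕ_  : Vert → HEdge → Set

module _ (H : Hypergraph) where
  open Hypergraph H

  Adjacent : Vert → Vert → Set
  Adjacent x y = ∃ λ e → (x ∈ₕ e) × (y ∈ₕ e)

  Dominating : {m : ℕ} → (Fin m → Vert) → Set
  Dominating {m} D = ∀ x → (∃ λ (i : Fin m) → D i ≡ x) ⊎ (∃ λ (i : Fin m) → Adjacent x (D i))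

  DominationNumberIs : ℕ → Set
  DominationNumberIs m =
    (∃ λ (D : Fin m → Vert) → Injective _≡_ _≡_ D × Dominating D)
    × (∀ m' (D : Fin m' → Vert) → Dominating D → m ≤ m')

  PairwiseDisjoint : {n : ℕ} → (Fin n → HEdge) → Set
  PairwiseDisjoint M = ∀ i j → ¬ i ≡ j → ∀ x → x ∈ₕ M i → x ∈ₕ M j → ⊥

  MatchingNumberIs : ℕ → Set
  MatchingNumberIs n =
    (∃ λ (M : Fin n → HEdge) → Injective _≡_ _≡_ M × PairwiseDisjoint M)
    × (∀ n' (M : Fin n' → HEdge) → Injective _≡_ _≡_ M → PairwiseDisjoint M → n' ≤ n)

record Graph : Set where
  field
    p      : ℕ
    adj    : Fin p → Fin p → Bool
    sym    : ∀ u v → adj u v ≡ adj v u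
    irrefl : ∀ v → ¬ T (adj v v)

-- an edge uv is recorded once, with u < v
record Edge (G : Graph) : Set where
  constructor edge
  open Graph G
  field
    u   : Fin p
    v   : Fin p
    u<v : u Fin.< v
    uv  : T (adj u v)

-- Dilations of G of rank k with every 𝐞 non-empty (the class Γ₁)

record Dilation₁ (G : Graph) (k : ℕ) : Set where
  open Graph G
  field
    s     : Fin p → ℕ            -- s_v = |𝐯|
    s-pos : ∀ v → 1 ≤ s v
    t     : Edge G → ℕ           -- t_e = |𝐞|
    t-pos : ∀ e → 1 ≤ t e         -- 𝐞 ≠ ∅  (Γ₁)
    bound : ∀ e → s (Edge.u e) + s (Edge.v e) + t e ≤ k
                                  -- gives s_u + s_v ≤ k and |𝐞| ≤ k - s_u - s_v

dilationHypergraph : {G : Graph} {k : ℕ} → Dilation₁ G k → Hypergraph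
dilationHypergraph {G} D = record
  { Vert  = (Σ (Fin (Graph.p G)) λ v → Fin (s v)) ⊎ (Σ (Edge G) λ e → Fin (t e))
  ; HEdge = Edge G
  ; _∈ₕ_  = mem
  }
  where
  open Dilation₁ D
  mem : ((Σ (Fin (Graph.p G)) λ v → Fin (s v)) ⊎ (Σ (Edge G) λ e → Fin (t e))) → Edge G → Set
  mem (inj₁ (w , _)) e = (w ≡ Edge.u e) ⊎ (w ≡ Edge.v e)
  mem (inj₂ (e' , _)) e = e' ≡ e

-- Take n disjoint graphs on three vertices: the first a = m − n are triangles, the
-- others are paths with centre 0. Any two edges on three vertices meet, so a matching of
-- a dilation uses at most one edge per component and ν = n. Every hyperedge 𝐮 ∪ 𝐯 ∪ 𝐞
-- has a private vertex in 𝐞 (this is where Γ₁ is used), so dominating sets are exactly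
-- the vertex sets meeting every hyperedge (no vertex is isolated). A path is met by its
-- centre alone, while no vertex lies on all three edges of a triangle, so γ = n + a = m.
module Submission where

open import Defs
open import Data.Nat using (ℕ; _≤_; _<_; _+_; _*_; _∸_)
open import Data.Product using (Σ; _×_)

open import Data.Nat using (s≤s)
import Data.Nat.Properties as ℕ
open import Data.Fin using (Fin; suc; toℕ; combine; quotient; remainder; splitAt; join; inject≤; fromℕ<)
open import Data.Fin.Patterns using (0F; 1F; 2F; 3F)
open import Data.Fin.Properties
  using (_≟_; <-cmp; pigeonhole; injective⇒≤; combine-injective; remQuot-combine; combine-remQuot;
         join-splitAt; splitAt-join; inject≤-injective; toℕ-inject≤; toℕ-fromℕ<; toℕ<n; toℕ-injective)
open import Data.Bool using (T)
open import Data.Vec using (_∷_; []; lookup)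
open import Data.Product using (_,_; proj₁; proj₂; ∃)
open import Data.Sum using (_⊎_; inj₁; inj₂; [_,_]′)
open import Data.Empty using (⊥; ⊥-elim)
open import Function using (_∘_; id)
open import Relation.Nullary using (Dec; yes; no; contradiction)
open import Relation.Nullary.Decidable using (⌊_⌋; toWitness; fromWitness; _×-dec_; _⊎-dec_; ¬?)
open import Relation.Binary.Definitions using (tri<; tri≈; tri>)
open import Relation.Binary.PropositionalEquality
  using (_≡_; _≢_; refl; sym; trans; cong; subst)
open import Function.Definitions using (Injective)

two-pairs-meet : {a b c d : Fin 3} → a ≢ b → c ≢ d → (c ≡ a ⊎ c ≡ b) ⊎ (d ≡ a ⊎ d ≡ b)
two-pairs-meet {a} {b} {c} {d} a≢b c≢d with pigeonhole (ℕ.n<1+n 3) (lookup (a ∷ b ∷ c ∷ d ∷ []))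
... | 0F , 1F , _ , a≡b = contradiction a≡b a≢b
... | 0F , 2F , _ , a≡c = inj₁ (inj₁ (sym a≡c))
... | 0F , 3F , _ , a≡d = inj₂ (inj₁ (sym a≡d))
... | 1F , 2F , _ , b≡c = inj₁ (inj₂ (sym b≡c))
... | 1F , 3F , _ , b≡d = inj₂ (inj₂ (sym b≡d))
... | 2F , 3F , _ , c≡d = contradiction c≡d c≢d
... | 1F , 1F , s≤s () , _
... | suc (suc _) , 1F , s≤s () , _
... | suc (suc _) , 2F , s≤s (s≤s ()) , _
... | suc (suc (suc _)) , 3F , s≤s (s≤s (s≤s ())) , _

no-position-on-three-sides : {ℓ : Fin 3} → ℓ ≡ 0F ⊎ ℓ ≡ 1F → ℓ ≡ 1F ⊎ ℓ ≡ 2F → ℓ ≡ 0F ⊎ ℓ ≡ 2F → ⊥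
no-position-on-three-sides (inj₁ refl) (inj₁ ()) _
no-position-on-three-sides (inj₁ refl) (inj₂ ()) _
no-position-on-three-sides (inj₂ refl) _ (inj₁ ())
no-position-on-three-sides (inj₂ refl) _ (inj₂ ())

splitAt-injective : ∀ m {n} {i j : Fin (m + n)} → splitAt m i ≡ splitAt m j → i ≡ j
splitAt-injective m {n} {i} {j} eq =
  trans (sym (join-splitAt m n i)) (trans (cong (join m n) eq) (join-splitAt m n j))

module _ (H : Hypergraph) where
  open Hypergraph H

  Transversal : {m : ℕ} → (Fin m → Vert) → Set
  Transversal T = ∀ e → ∃ λ i → T i ∈ₕ e

  Meet : HEdge → HEdge → Set
  Meet e e' = ∃ λ x → x ∈ₕ e × x ∈ₕ e'

  HasPrivateVertex : HEdge → Set
  HasPrivateVertex e = ∃ λ x → x ∈ₕ e × ∀ e' → x ∈ₕ e' → e' ≡ e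

  NoIsolatedVertex : Set
  NoIsolatedVertex = ∀ x → ∃ λ e → x ∈ₕ e

  transversal⇒dominating : NoIsolatedVertex → {m : ℕ} {T : Fin m → Vert} → Transversal T → Dominating H T
  transversal⇒dominating covered hits x =
    let e , x∈e = covered x
        i , Ti∈e = hits e
    in inj₂ (i , e , x∈e , Ti∈e)

  dominating⇒transversal : (∀ e → HasPrivateVertex e) →
                           {m : ℕ} {D : Fin m → Vert} → Dominating H D → Transversal D
  dominating⇒transversal private-vertex {D = D} dom e with private-vertex e
  ... | x , x∈e , only-e with dom x
  ...   | inj₁ (i , refl) = i , x∈e
  ...   | inj₂ (i , e' , x∈e' , Di∈e') = i , subst (D i ∈ₕ_) (only-e e' x∈e') Di∈e'

  matchingNumberIs : {n : ℕ} (χ : Vert → Fin n) (κ : HEdge → Fin n) →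
                     (∀ {x e} → x ∈ₕ e → χ x ≡ κ e) →
                     (∀ {e e'} → κ e ≡ κ e' → Meet e e') →
                     (σ : Fin n → HEdge) → (∀ c → κ (σ c) ≡ c) →
                     MatchingNumberIs H n
  matchingNumberIs χ κ χ≡κ meet σ κσ≡id =
    (σ , σ-injective , σ-disjoint) , λ n' M _ M-disjoint → injective⇒≤ (κM-injective M M-disjoint)
    where
    σ-injective : Injective _≡_ _≡_ σ
    σ-injective {i} {j} σi≡σj = trans (sym (κσ≡id i)) (trans (cong κ σi≡σj) (κσ≡id j))

    σ-disjoint : PairwiseDisjoint H σ
    σ-disjoint i j i≢j x x∈σi x∈σj =
      i≢j (trans (sym (κσ≡id i)) (trans (sym (χ≡κ x∈σi)) (trans (χ≡κ x∈σj) (κσ≡id j))))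

    κM-injective : ∀ {n'} (M : Fin n' → HEdge) → PairwiseDisjoint H M → Injective _≡_ _≡_ (κ ∘ M)
    κM-injective M M-disjoint {i} {j} κMi≡κMj with i ≟ j
    ... | yes i≡j = i≡j
    ... | no i≢j = let x , x∈Mi , x∈Mj = meet κMi≡κMj in ⊥-elim (M-disjoint i j i≢j x x∈Mi x∈Mj)

  dominationNumberIs : NoIsolatedVertex → (∀ e → HasPrivateVertex e) →
                       {m : ℕ} (T : Fin m → Vert) → Injective _≡_ _≡_ T → Transversal T →
                       (∀ {m'} (T' : Fin m' → Vert) → Transversal T' → m ≤ m') →
                       DominationNumberIs H m
  dominationNumberIs covered private-vertex T T-injective hits minimal =
    (T , T-injective , transversal⇒dominating covered hits) ,
    λ m' D dom → minimal D (dominating⇒transversal private-vertex dom)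

module _ (G : Graph) where
  open Graph G using (p; adj; irrefl) renaming (sym to adj-sym)

  IsEnd : Fin p → Edge G → Set
  IsEnd w e = w ≡ Edge.u e ⊎ w ≡ Edge.v e

  toEdge : {u v : Fin p} → T (adj u v) → Edge G
  toEdge {u} {v} uv with <-cmp u v
  ... | tri< u<v _ _ = edge u v u<v uv
  ... | tri≈ _ refl _ = ⊥-elim (irrefl u uv)
  ... | tri> _ _ v<u = edge v u v<u (subst T (adj-sym u v) uv)

  toEdge-ends : {u v : Fin p} (uv : T (adj u v)) →
                (Edge.u (toEdge uv) ≡ u × Edge.v (toEdge uv) ≡ v) ⊎ (Edge.u (toEdge uv) ≡ v × Edge.v (toEdge uv) ≡ u)
  toEdge-ends {u} {v} uv with <-cmp u v
  ... | tri< _ _ _ = inj₁ (refl , refl)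
  ... | tri≈ _ refl _ = ⊥-elim (irrefl u uv)
  ... | tri> _ _ _ = inj₂ (refl , refl)

  toEdge-∋ˡ : {u v : Fin p} (uv : T (adj u v)) → IsEnd u (toEdge uv)
  toEdge-∋ˡ uv with toEdge-ends uv
  ... | inj₁ (u≡u , _) = inj₁ (sym u≡u)
  ... | inj₂ (_ , v≡u) = inj₂ (sym v≡u)

  toEdge-∋ʳ : {u v : Fin p} (uv : T (adj u v)) → IsEnd v (toEdge uv)
  toEdge-∋ʳ uv with toEdge-ends uv
  ... | inj₁ (_ , v≡v) = inj₂ (sym v≡v)
  ... | inj₂ (u≡v , _) = inj₁ (sym u≡v)

  IsEnd-toEdge : {u v w : Fin p} (uv : T (adj u v)) → IsEnd w (toEdge uv) → w ≡ u ⊎ w ≡ v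
  IsEnd-toEdge uv w∈e with toEdge-ends uv | w∈e
  ... | inj₁ (u≡u , _) | inj₁ w≡u = inj₁ (trans w≡u u≡u)
  ... | inj₁ (_ , v≡v) | inj₂ w≡v = inj₂ (trans w≡v v≡v)
  ... | inj₂ (u≡v , _) | inj₁ w≡u = inj₂ (trans w≡u u≡v)
  ... | inj₂ (_ , v≡u) | inj₂ w≡v = inj₁ (trans w≡v v≡u)

module _ {G : Graph} {k : ℕ} (D : Dilation₁ G k) where
  open Graph G using (p)
  open Dilation₁ D using (s-pos; t-pos)
  open Hypergraph (dilationHypergraph D) using (Vert; _∈ₕ_)

  blob : Fin p → Vert
  blob w = inj₁ (w , fromℕ< (s-pos w))

  blob-injective : Injective _≡_ _≡_ blob
  blob-injective refl = refl

  edgeBlob-private : ∀ e → HasPrivateVertex (dilationHypergraph D) e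
  edgeBlob-private e = inj₂ (e , fromℕ< (t-pos e)) , refl , λ _ → sym

  dilation-noIsolatedVertex : (∀ w → ∃ λ e → IsEnd G w e) → NoIsolatedVertex (dilationHypergraph D)
  dilation-noIsolatedVertex every-vertex-is-an-end (inj₁ (w , _)) = every-vertex-is-an-end w
  dilation-noIsolatedVertex _ (inj₂ (e , _)) = e , refl

  colourBlobs : {A : Set} → (Fin p → A) → (Edge G → A) → Vert → A
  colourBlobs χ κ (inj₁ (w , _)) = χ w
  colourBlobs χ κ (inj₂ (e , _)) = κ e

  ∈⇒colourBlobs≡ : {A : Set} (χ : Fin p → A) (κ : Edge G → A) → (∀ {w e} → IsEnd G w e → χ w ≡ κ e) →
                   ∀ {x e} → x ∈ₕ e → colourBlobs χ κ x ≡ κ e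
  ∈⇒colourBlobs≡ χ κ χ≡κ {inj₁ _} w∈e = χ≡κ w∈e
  ∈⇒colourBlobs≡ χ κ χ≡κ {inj₂ _} refl = refl

-- Component c is a triangle if toℕ c < a and otherwise the path 1F – 0F – 2F.
module Components (n a : ℕ) (a≤n : a ≤ n) where

  Vertex : Set
  Vertex = Fin (n * 3)

  vertex : Fin n → Fin 3 → Vertex
  vertex = combine

  component : Vertex → Fin n
  component = quotient 3

  position : Vertex → Fin 3
  position = remainder {n} 3

  component-vertex : ∀ c ℓ → component (vertex c ℓ) ≡ c
  component-vertex c ℓ = cong proj₁ (remQuot-combine c ℓ)

  position-vertex : ∀ c ℓ → position (vertex c ℓ) ≡ ℓ
  position-vertex c ℓ = cong proj₂ (remQuot-combine c ℓ)

  vertex-coordinates : ∀ {w c ℓ} → component w ≡ c → position w ≡ ℓ → w ≡ vertex c ℓ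
  vertex-coordinates {w} refl refl = sym (combine-remQuot {n} 3 w)

  coordinates-injective : ∀ {w w'} → component w ≡ component w' → position w ≡ position w' → w ≡ w'
  coordinates-injective c≡ ℓ≡ = trans (vertex-coordinates c≡ ℓ≡) (sym (vertex-coordinates refl refl))

  Triangle : Fin n → Set
  Triangle c = toℕ c < a

  Linked : Vertex → Vertex → Set
  Linked u v = component u ≡ component v × position u ≢ position v
             × (Triangle (component u) ⊎ position u ≡ 0F ⊎ position v ≡ 0F)

  linked? : ∀ u v → Dec (Linked u v)
  linked? u v = component u ≟ component v ×-dec ¬? (position u ≟ position v)
              ×-dec (toℕ (component u) ℕ.<? a ⊎-dec position u ≟ 0F ⊎-dec position v ≟ 0F)

  linked-sym : ∀ {u v} → Linked u v → Linked v u
  linked-sym (c≡ , ℓ≢ , inj₁ t) = sym c≡ , ℓ≢ ∘ sym , inj₁ (subst Triangle c≡ t)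
  linked-sym (c≡ , ℓ≢ , inj₂ (inj₁ u₀)) = sym c≡ , ℓ≢ ∘ sym , inj₂ (inj₂ u₀)
  linked-sym (c≡ , ℓ≢ , inj₂ (inj₂ v₀)) = sym c≡ , ℓ≢ ∘ sym , inj₂ (inj₁ v₀)

  ⌊linked?⌋-sym : ∀ u v → ⌊ linked? u v ⌋ ≡ ⌊ linked? v u ⌋
  ⌊linked?⌋-sym u v with linked? u v | linked? v u
  ... | yes _ | yes _ = refl
  ... | no _ | no _ = refl
  ... | yes uv | no ¬vu = contradiction (linked-sym uv) ¬vu
  ... | no ¬uv | yes vu = contradiction (linked-sym vu) ¬uv

  graph : Graph
  graph = record
    { p = n * 3
    ; adj = λ u v → ⌊ linked? u v ⌋
    ; sym = ⌊linked?⌋-sym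
    ; irrefl = λ v vv → proj₁ (proj₂ (toWitness vv)) refl
    }

  linked-edge : (e : Edge graph) → Linked (Edge.u e) (Edge.v e)
  linked-edge e = toWitness (Edge.uv e)

  edgeComponent : Edge graph → Fin n
  edgeComponent e = component (Edge.u e)

  end-component : ∀ e {w} → IsEnd graph w e → component w ≡ edgeComponent e
  end-component e (inj₁ refl) = refl
  end-component e (inj₂ refl) = sym (proj₁ (linked-edge e))

  edgeIn : (c : Fin n) (ℓ ℓ' : Fin 3) → ℓ ≢ ℓ' → Triangle c ⊎ ℓ ≡ 0F ⊎ ℓ' ≡ 0F → Edge graph
  edgeIn c ℓ ℓ' ℓ≢ℓ' allowed = toEdge graph (fromWitness vertices-linked)
    where
    vertices-linked : Linked (vertex c ℓ) (vertex c ℓ')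
    vertices-linked rewrite component-vertex c ℓ | component-vertex c ℓ'
                          | position-vertex c ℓ | position-vertex c ℓ' = refl , ℓ≢ℓ' , allowed

  module _ {c : Fin n} {ℓ ℓ' : Fin 3} {ℓ≢ℓ' : ℓ ≢ ℓ'} {allowed : Triangle c ⊎ ℓ ≡ 0F ⊎ ℓ' ≡ 0F} where
    edgeIn-∋ˡ : IsEnd graph (vertex c ℓ) (edgeIn c ℓ ℓ' ℓ≢ℓ' allowed)
    edgeIn-∋ˡ = toEdge-∋ˡ graph {vertex c ℓ} {vertex c ℓ'} _

    edgeIn-∋ʳ : IsEnd graph (vertex c ℓ') (edgeIn c ℓ ℓ' ℓ≢ℓ' allowed)
    edgeIn-∋ʳ = toEdge-∋ʳ graph {vertex c ℓ} {vertex c ℓ'} _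

    edgeIn-component : edgeComponent (edgeIn c ℓ ℓ' ℓ≢ℓ' allowed) ≡ c
    edgeIn-component = trans (sym (end-component (edgeIn c ℓ ℓ' ℓ≢ℓ' allowed) edgeIn-∋ˡ)) (component-vertex c ℓ)

    edgeIn-position : ∀ {w} → IsEnd graph w (edgeIn c ℓ ℓ' ℓ≢ℓ' allowed) → position w ≡ ℓ ⊎ position w ≡ ℓ'
    edgeIn-position w∈e with IsEnd-toEdge graph {vertex c ℓ} {vertex c ℓ'} _ w∈e
    ... | inj₁ refl = inj₁ (position-vertex c ℓ)
    ... | inj₂ refl = inj₂ (position-vertex c ℓ')

  spoke₁ spoke₂ : Fin n → Edge graph
  spoke₁ c = edgeIn c 0F 1F (λ ()) (inj₂ (inj₁ refl))
  spoke₂ c = edgeIn c 0F 2F (λ ()) (inj₂ (inj₁ refl))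

  rim : (c : Fin n) → Triangle c → Edge graph
  rim c t = edgeIn c 1F 2F (λ ()) (inj₁ t)

  every-vertex-is-an-end : ∀ w → ∃ λ e → IsEnd graph w e
  every-vertex-is-an-end w with position w ≟ 0F
  ... | yes w₀ = spoke₁ c , subst (λ x → IsEnd graph x (spoke₁ c)) (sym (vertex-coordinates refl w₀)) edgeIn-∋ˡ
    where c = component w
  ... | no w≢0 = e , subst (λ x → IsEnd graph x e) (sym (vertex-coordinates refl refl)) edgeIn-∋ʳ
    where e = edgeIn (component w) 0F (position w) (w≢0 ∘ sym) (inj₂ (inj₁ refl))

  same-position-end : ∀ e e' {w w'} → edgeComponent e ≡ edgeComponent e' →
                      IsEnd graph w e → IsEnd graph w' e' → position w' ≡ position w → IsEnd graph w e'
  same-position-end e e' c≡c' w∈e w'∈e' ℓ≡ = subst (λ x → IsEnd graph x e')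
    (coordinates-injective (trans (end-component e' w'∈e') (trans (sym c≡c') (sym (end-component e w∈e)))) ℓ≡) w'∈e'

  -- Each edge joins two distinct positions, and there are only three positions.
  component-edges-meet : ∀ {e e'} → edgeComponent e ≡ edgeComponent e' → ∃ λ w → IsEnd graph w e × IsEnd graph w e'
  component-edges-meet {e} {e'} c≡c' with two-pairs-meet (proj₁ (proj₂ (linked-edge e))) (proj₁ (proj₂ (linked-edge e')))
  ... | inj₁ (inj₁ ℓ≡) = Edge.u e , inj₁ refl , same-position-end e e' c≡c' (inj₁ refl) (inj₁ refl) ℓ≡
  ... | inj₁ (inj₂ ℓ≡) = Edge.v e , inj₂ refl , same-position-end e e' c≡c' (inj₂ refl) (inj₁ refl) ℓ≡
  ... | inj₂ (inj₁ ℓ≡) = Edge.u e , inj₁ refl , same-position-end e e' c≡c' (inj₁ refl) (inj₂ refl) ℓ≡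
  ... | inj₂ (inj₂ ℓ≡) = Edge.v e , inj₂ refl , same-position-end e e' c≡c' (inj₂ refl) (inj₂ refl) ℓ≡

  triangle : Fin a → Fin n
  triangle j = inject≤ j a≤n

  triangle-isTriangle : ∀ j → Triangle (triangle j)
  triangle-isTriangle j = subst (_< a) (sym (toℕ-inject≤ j a≤n)) (toℕ<n j)

  triangle-onto : ∀ {c} → Triangle c → ∃ λ j → triangle j ≡ c
  triangle-onto t = fromℕ< t , toℕ-injective (trans (toℕ-inject≤ (fromℕ< t) a≤n) (toℕ-fromℕ< t))

  Slot : Set
  Slot = Fin n ⊎ Fin a

  slotComponent : Slot → Fin n
  slotComponent (inj₁ c) = c
  slotComponent (inj₂ j) = triangle j

  slotVertex : Slot → Vertex
  slotVertex (inj₁ c) = vertex c 0F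
  slotVertex (inj₂ j) = vertex (triangle j) 1F

  slotVertex-injective : Injective _≡_ _≡_ slotVertex
  slotVertex-injective {inj₁ c} {inj₁ c'} eq = cong inj₁ (proj₁ (combine-injective c 0F c' 0F eq))
  slotVertex-injective {inj₁ c} {inj₂ j} eq with () ← proj₂ (combine-injective c 0F (triangle j) 1F eq)
  slotVertex-injective {inj₂ j} {inj₁ c} eq with () ← proj₂ (combine-injective (triangle j) 1F c 0F eq)
  slotVertex-injective {inj₂ j} {inj₂ j'} eq =
    cong inj₂ (inject≤-injective a≤n a≤n j j' (proj₁ (combine-injective (triangle j) 1F (triangle j') 1F eq)))

  slots≤ : ∀ {m} {g : Slot → Fin m} → Injective _≡_ _≡_ g → n + a ≤ m
  slots≤ g-injective = injective⇒≤ (splitAt-injective n ∘ g-injective)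

  -- An edge avoiding the centres lies in a triangle and joins positions 1F and 2F.
  slotVertex-on-every-edge : ∀ e → ∃ λ s → IsEnd graph (slotVertex s) e
  slotVertex-on-every-edge e with linked-edge e
  ... | c≡ , ℓ≢ , allowed with position (Edge.u e) ≟ 0F | position (Edge.v e) ≟ 0F
  ... | yes u₀ | _ = inj₁ (edgeComponent e) , inj₁ (sym (vertex-coordinates refl u₀))
  ... | no _ | yes v₀ = inj₁ (edgeComponent e) , inj₂ (sym (vertex-coordinates (sym c≡) v₀))
  ... | no u≢0 | no v≢0
        with triangle-onto ([ id , [ (λ u₀ → contradiction u₀ u≢0) , (λ v₀ → contradiction v₀ v≢0) ]′ ]′ allowed)
           | two-pairs-meet {0F} {1F} (λ ()) ℓ≢
  ...   | j , j↦c | inj₁ (inj₁ u₀) = contradiction u₀ u≢0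
  ...   | j , j↦c | inj₁ (inj₂ u₁) = inj₂ j , inj₁ (sym (vertex-coordinates (sym j↦c) u₁))
  ...   | j , j↦c | inj₂ (inj₁ v₀) = contradiction v₀ v≢0
  ...   | j , j↦c | inj₂ (inj₂ v₁) = inj₂ j , inj₂ (sym (vertex-coordinates (trans (sym c≡) (sym j↦c)) v₁))

  module _ {k : ℕ} (D : Dilation₁ graph k) where
    H : Hypergraph
    H = dilationHypergraph D
    open Hypergraph H using (Vert; _∈ₕ_)

    blobComponent : Vert → Fin n
    blobComponent = colourBlobs D component edgeComponent

    ∈⇒blobComponent≡ : ∀ {x e} → x ∈ₕ e → blobComponent x ≡ edgeComponent e
    ∈⇒blobComponent≡ = ∈⇒colourBlobs≡ D component edgeComponent (λ {_} {e} → end-component e)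

    no-vertex-on-whole-triangle : ∀ c (t : Triangle c) x → x ∈ₕ spoke₁ c → x ∈ₕ rim c t → x ∈ₕ spoke₂ c → ⊥
    no-vertex-on-whole-triangle c t (inj₁ _) x∈spoke₁ x∈rim x∈spoke₂ =
      no-position-on-three-sides (edgeIn-position x∈spoke₁) (edgeIn-position x∈rim) (edgeIn-position x∈spoke₂)
    no-vertex-on-whole-triangle c t (inj₂ _) refl spoke₁≡rim _
      with edgeIn-position (subst (IsEnd graph (vertex c 0F)) spoke₁≡rim edgeIn-∋ˡ)
    ... | inj₁ 0≡1 with () ← trans (sym (position-vertex c 0F)) 0≡1
    ... | inj₂ 0≡2 with () ← trans (sym (position-vertex c 0F)) 0≡2

    transversal-size : ∀ {m'} (T : Fin m' → Vert) → Transversal H T → n + a ≤ m'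
    transversal-size {m'} T hits = slots≤ pick-injective
      where
      onSpoke : Fin n → Fin m'
      onSpoke c = proj₁ (hits (spoke₁ c))

      secondOnTriangle : ∀ c → Triangle c → ∃ λ i → blobComponent (T i) ≡ c × i ≢ onSpoke c
      secondOnTriangle c t with hits (rim c t) | hits (spoke₂ c)
      ... | i , Ti∈rim | i' , Ti'∈spoke₂ with i ≟ onSpoke c
      ...   | no i≢ = i , trans (∈⇒blobComponent≡ Ti∈rim) edgeIn-component , i≢
      ...   | yes refl = i' , trans (∈⇒blobComponent≡ Ti'∈spoke₂) edgeIn-component ,
                λ { refl → no-vertex-on-whole-triangle c t _ (proj₂ (hits (spoke₁ c))) Ti∈rim Ti'∈spoke₂ }

      pick : Slot → Fin m'
      pick (inj₁ c) = onSpoke c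
      pick (inj₂ j) = proj₁ (secondOnTriangle (triangle j) (triangle-isTriangle j))

      pick-component : ∀ s → blobComponent (T (pick s)) ≡ slotComponent s
      pick-component (inj₁ c) = trans (∈⇒blobComponent≡ (proj₂ (hits (spoke₁ c)))) edgeIn-component
      pick-component (inj₂ j) = proj₁ (proj₂ (secondOnTriangle (triangle j) (triangle-isTriangle j)))

      pick-slotComponent : ∀ {s s'} → pick s ≡ pick s' → slotComponent s ≡ slotComponent s'
      pick-slotComponent {s} {s'} eq =
        trans (sym (pick-component s)) (trans (cong (blobComponent ∘ T) eq) (pick-component s'))

      pick-injective : Injective _≡_ _≡_ pick
      pick-injective {inj₁ c} {inj₁ c'} eq = cong inj₁ (pick-slotComponent {inj₁ c} {inj₁ c'} eq)
      pick-injective {inj₁ c} {inj₂ j} eq with refl ← pick-slotComponent {inj₁ c} {inj₂ j} eq =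
        contradiction (sym eq) (proj₂ (proj₂ (secondOnTriangle (triangle j) (triangle-isTriangle j))))
      pick-injective {inj₂ j} {inj₁ c} eq with refl ← pick-slotComponent {inj₁ c} {inj₂ j} (sym eq) =
        contradiction eq (proj₂ (proj₂ (secondOnTriangle (triangle j) (triangle-isTriangle j))))
      pick-injective {inj₂ j} {inj₂ j'} eq = cong inj₂ (inject≤-injective a≤n a≤n j j' (pick-slotComponent {inj₂ j} {inj₂ j'} eq))

    centresAndFirstLeaves : Fin (n + a) → Vert
    centresAndFirstLeaves = blob D ∘ slotVertex ∘ splitAt n

    centresAndFirstLeaves-transversal : Transversal H centresAndFirstLeaves
    centresAndFirstLeaves-transversal e =
      let s , s∈e = slotVertex-on-every-edge e
      in join n a s , subst (λ s → IsEnd graph (slotVertex s) e) (sym (splitAt-join n a s)) s∈e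

    matchingNumber : MatchingNumberIs H n
    matchingNumber = matchingNumberIs H blobComponent edgeComponent ∈⇒blobComponent≡
      (λ {e} {e'} same → let w , w∈e , w∈e' = component-edges-meet {e} {e'} same in blob D w , w∈e , w∈e')
      spoke₁ (λ c → edgeIn-component)

    dominationNumber : DominationNumberIs H (n + a)
    dominationNumber = dominationNumberIs H (dilation-noIsolatedVertex D every-vertex-is-an-end) (edgeBlob-private D)
      centresAndFirstLeaves (splitAt-injective n ∘ slotVertex-injective ∘ blob-injective D)
      centresAndFirstLeaves-transversal transversal-size

theorem5 : ∀ (n : ℕ) → 2 ≤ n → ∀ (m : ℕ) → n + 1 ≤ m → m ≤ 2 * n ∸ 1 →
    Σ Graph λ G → ∀ (k : ℕ) → 3 ≤ k → (D : Dilation₁ G k) →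
    MatchingNumberIs (dilationHypergraph D) n × DominationNumberIs (dilationHypergraph D) m
theorem5 n _ m n+1≤m m≤2n∸1 =
  graph , λ k _ D → matchingNumber D , subst (DominationNumberIs (dilationHypergraph D)) (ℕ.m+[n∸m]≡n n≤m) (dominationNumber D)
  where
  n≤m : n ≤ m
  n≤m = ℕ.≤-trans (ℕ.m≤m+n n 1) n+1≤m

  m∸n≤n : m ∸ n ≤ n
  m∸n≤n = subst (m ∸ n ≤_) (ℕ.+-identityʳ n) (ℕ.m≤n+o⇒m∸n≤o m n (ℕ.≤-trans m≤2n∸1 (ℕ.m∸n≤m (2 * n) 1)))

  open Components n (m ∸ n) m∸n≤n
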